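{- Fix $n\ge 2$ and let $M=M_n$. Suppose the computation of $M(x)$ terminates. Then: (1) for every $0\le d<M(x)$, the computation of $M(x+d)$ terminates and $M(x+d)=M(x)-d$; (2) if $x\ge 0$, then $t_i(x)\ge i\,M(x)$ for each $0\le i\le n$.
   Context: $M_n$ is the (a priori partial) function computed by the recursive procedure: on input $x<0$ return $-x$; on input $x\ge 0$ set $t_0(x)=1$, recursively compute $t_i(x)=M_n(x-t_{i-1}(x))$ for $i=1,\ldots,n$, and return $t_n(x)/n$. "The computation terminates" means only finitely many recursive calls are made.
   Formalization: The inputs x and d, and the values of $M_n$, are rational numbers instead of real numbers. -}

module Defs where

open import Data.Nat using (ℕ; zero; suc; NonZero)
open import Data.Integer using (+_)
open import Data.Rational using (ℚ; 0ℚ; 1ℚ; _<_; _≤_; -_; _-_; _*_; _/_)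

-- Big-step semantics of the recursive procedure M_n (inputs/outputs in ℚ).
-- Ev n x v   : the computation of M_n(x) terminates (finite derivation =
--              finitely many recursive calls) with value v.
-- Ch n x i t : t_i(x) = t, i.e. the chain t_0(x)=1, t_{j+1}(x)=M_n(x - t_j(x))
--              has been computed up to index i with value t.
module _ (n : ℕ) .{{_ : NonZero n}} where
  data Ev : ℚ → ℚ → Set
  data Ch (x : ℚ) : ℕ → ℚ → Set

  data Ev where
    ev-neg    : ∀ {x} → x < 0ℚ → Ev x (- x)
    ev-nonneg : ∀ {x t} → 0ℚ ≤ x → Ch x n t → Ev x (t * ((+ 1) / n))

  data Ch x where
    ch-zero : Ch x zero 1ℚ
    ch-suc  : ∀ {i t t'} → Ch x i t → Ev (x - t) t' → Ch x (suc i) t'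

ℕ→ℚ : ℕ → ℚ
ℕ→ℚ i = (+ i) / 1

-- Call M sliding at x if M(x + d) = M(x) − d for 0 ≤ d < M(x). If the
-- recursive call at x − t_i(x) is sliding, then t_{i+1}(x) ≤ t_i(x) + M(x):
-- were t_{i+1}(x) > t_i(x), sliding by t_i(x) would land on M(x) itself.
-- Summing from i to n and using t_n(x) = n M(x) gives t_i(x) ≥ i M(x). Hence
-- shifting x by d < M(x) moves the i-th argument x − t_{i−1}(x) by i d < t_i(x),
-- inside the sliding range of that call, so t_i(x + d) = t_i(x) − i d and M is
-- sliding at x. Both parts thus follow together by induction on the
-- computation of M(x).
module Submission where

open import Defs
open import Data.Nat using (ℕ; NonZero; suc; z≤n; s≤s)
import Data.Nat as ℕ
import Data.Nat.Properties as ℕ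
open import Data.Nat.Coprimality using (Coprime; 1-coprimeTo) renaming (sym to coprime-sym)
import Data.Integer as ℤ
import Data.Integer.Properties as ℤ
open import Data.Rational using (ℚ; 0ℚ; 1ℚ; mkℚ; _<_; _≤_; _+_; _-_; _*_; -_; 1/_; _/_; positive; nonNegative)
open import Data.Rational.Properties
open import Data.Rational.Solver using (module +-*-Solver)
open import Data.Product using (_×_; _,_)
open import Data.Sum using (inj₁; inj₂)
open import Data.Unit using (⊤; tt)
open import Data.Empty using (⊥-elim)
open import Relation.Nullary using (yes; no)
open import Relation.Binary.PropositionalEquality

open +-*-Solver

ℕ→ℚ-suc-pos : ∀ k → 0ℚ < ℕ→ℚ (suc k)
ℕ→ℚ-suc-pos k = positive⁻¹ (ℕ→ℚ (suc k)) {{normalize-pos (suc k) 1}}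

-- 1ℚ + mkℚ (+ k) 0 _ computes to (+ 1 ℤ.+ + k ℤ.* + 1) / 1, but ℕ→ℚ k does not.
ℕ→ℚ-suc : ∀ k → ℕ→ℚ (suc k) ≡ 1ℚ + ℕ→ℚ k
ℕ→ℚ-suc k = begin
  ℕ→ℚ (suc k)             ≡⟨ cong (λ i → (ℤ.+ 1 ℤ.+ i) / 1) (sym (ℤ.*-identityʳ (ℤ.+ k))) ⟩
  1ℚ + mkℚ (ℤ.+ k) 0 k⊥1  ≡⟨ cong (λ q → 1ℚ + q) (sym (normalize-coprime k⊥1)) ⟩
  1ℚ + ℕ→ℚ k              ∎
  where
  open ≡-Reasoning
  k⊥1 : Coprime k 1
  k⊥1 = coprime-sym (1-coprimeTo k)

ℕ→ℚ-*-inverse : ∀ n .{{_ : NonZero n}} → ℕ→ℚ n * ((ℤ.+ 1) / n) ≡ 1ℚ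
ℕ→ℚ-*-inverse n@(suc _) = begin
  ℕ→ℚ n * ((ℤ.+ 1) / n)  ≡⟨ cong₂ _*_ (normalize-coprime n⊥1) (normalize-coprime (1-coprimeTo n)) ⟩
  p * 1/ p               ≡⟨ *-inverseʳ p ⟩
  1ℚ                     ∎
  where
  open ≡-Reasoning
  n⊥1 : Coprime n 1
  n⊥1 = coprime-sym (1-coprimeTo n)
  p : ℚ
  p = mkℚ (ℤ.+ n) 0 n⊥1

p≤p+q : ∀ {p q} → 0ℚ ≤ q → p ≤ p + q
p≤p+q {p} {q} 0≤q = subst (_≤ p + q) (+-identityʳ p) (+-monoʳ-≤ p 0≤q)

module _ (n : ℕ) .{{_ : NonZero n}} where

  n⁻¹ : ℚ
  n⁻¹ = (ℤ.+ 1) / n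

  n*[q*n⁻¹]≡q : ∀ q → ℕ→ℚ n * (q * n⁻¹) ≡ q
  n*[q*n⁻¹]≡q q = begin
    ℕ→ℚ n * (q * n⁻¹)  ≡⟨ solve 3 (λ N q r → N :* (q :* r) := q :* (N :* r)) refl (ℕ→ℚ n) q n⁻¹ ⟩
    q * (ℕ→ℚ n * n⁻¹)  ≡⟨ cong (q *_) (ℕ→ℚ-*-inverse n) ⟩
    q * 1ℚ             ≡⟨ *-identityʳ q ⟩
    q                  ∎
    where open ≡-Reasoning

  mutual
    Ev-functional : ∀ {x v w} → Ev n x v → Ev n x w → v ≡ w
    Ev-functional (ev-neg _)        (ev-neg _)        = refl
    Ev-functional (ev-neg x<0)      (ev-nonneg 0≤x _) = ⊥-elim (<-irrefl refl (<-≤-trans x<0 0≤x))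
    Ev-functional (ev-nonneg 0≤x _) (ev-neg x<0)      = ⊥-elim (<-irrefl refl (<-≤-trans x<0 0≤x))
    Ev-functional (ev-nonneg _ c)   (ev-nonneg _ c′)  = cong (_* n⁻¹) (Ch-functional c c′)

    Ch-functional : ∀ {x i t u} → Ch n x i t → Ch n x i u → t ≡ u
    Ch-functional ch-zero      ch-zero        = refl
    Ch-functional (ch-suc c e) (ch-suc c′ e′) with Ch-functional c c′
    ... | refl = Ev-functional e e′

  mutual
    Ev-pos : ∀ {x v} → Ev n x v → 0ℚ < v
    Ev-pos (ev-neg x<0)           = neg-antimono-< x<0
    Ev-pos (ev-nonneg {t = t} _ c) =
      positive⁻¹ (t * n⁻¹) {{pos*pos⇒pos t {{positive (Ch-pos c)}} _ {{normalize-pos 1 n}}}}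

    Ch-pos : ∀ {x i t} → Ch n x i t → 0ℚ < t
    Ch-pos ch-zero      = positive⁻¹ 1ℚ
    Ch-pos (ch-suc _ e) = Ev-pos e

  Slides : ℚ → ℚ → Set
  Slides x v = (d : ℚ) → 0ℚ ≤ d → d < v → Ev n (x + d) (v - d)

  SlidingLinks : ∀ {x k t} → Ch n x k t → Set
  SlidingLinks ch-zero = ⊤
  SlidingLinks {x} (ch-suc {t = s} {t′} c _) = SlidingLinks c × Slides (x - s) t′

  LowerBound : ℚ → ℚ → Set
  LowerBound x m = (i : ℕ) → i ℕ.≤ n → (t : ℚ) → Ch n x i t → ℕ→ℚ i * m ≤ t

  link-≤ : ∀ {x m s t} → Ev n x m → Slides (x - s) t → 0ℚ < s → t ≤ s + m
  link-≤ {x} {m} {s} {t} e-x slides 0<s with s <? t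
  ... | yes s<t = ≤-reflexive (begin
    t            ≡⟨ solve 2 (λ t s → t := s :+ (t :- s)) refl t s ⟩
    s + (t - s)  ≡⟨ cong (s +_) (Ev-functional e-x′ e-x) ⟩
    s + m        ∎)
    where
    open ≡-Reasoning
    e-x′ : Ev n x (t - s)
    e-x′ = subst (λ y → Ev n y (t - s)) (solve 2 (λ x s → (x :- s) :+ s := x) refl x s)
                 (slides s (<⇒≤ 0<s) s<t)
  ... | no s≮t = ≤-trans (≮⇒≥ s≮t) (p≤p+q (<⇒≤ (Ev-pos e-x)))

  Ch-increment-≤ : ∀ {x m k t i s} → Ev n x m → (c : Ch n x k t) → SlidingLinks c →
                   Ch n x i s → i ℕ.≤ k → t + ℕ→ℚ i * m ≤ s + ℕ→ℚ k * m
  Ch-increment-≤ _ ch-zero _ c-i z≤n = ≤-reflexive (cong (_+ _) (Ch-functional ch-zero c-i))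
  Ch-increment-≤ {_} {m} {suc k} {t} {i} {s} e-x c@(ch-suc {t = u} c-k _) (links , slides) c-i i≤1+k
    with ℕ.m≤n⇒m<n∨m≡n i≤1+k
  ... | inj₂ refl      = ≤-reflexive (cong (_+ _) (Ch-functional c c-i))
  ... | inj₁ (s≤s i≤k) = begin
    t + I * m             ≤⟨ +-monoˡ-≤ (I * m) (link-≤ e-x slides (Ch-pos c-k)) ⟩
    (u + m) + I * m       ≡⟨ solve 3 (λ u m Im → (u :+ m) :+ Im := (u :+ Im) :+ m) refl u m (I * m) ⟩
    (u + I * m) + m       ≤⟨ +-monoˡ-≤ m (Ch-increment-≤ e-x c-k links c-i i≤k) ⟩
    (s + K * m) + m       ≡⟨ solve 3 (λ s K m → (s :+ K :* m) :+ m := s :+ (con 1ℚ :+ K) :* m) refl s K m ⟩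
    s + (1ℚ + K) * m      ≡⟨ cong (λ q → s + q * m) (ℕ→ℚ-suc k) ⟨
    s + ℕ→ℚ (suc k) * m   ∎
    where
    open ≤-Reasoning
    I K : ℚ
    I = ℕ→ℚ i
    K = ℕ→ℚ k

  Ch-lower-bound : ∀ {x T} → 0ℚ ≤ x → (c : Ch n x n T) → SlidingLinks c → LowerBound x (T * n⁻¹)
  Ch-lower-bound {T = T} 0≤x c links i i≤n t c-i = begin
    I * m                    ≡⟨ solve 2 (λ T Im → Im := (T :+ Im) :- T) refl T (I * m) ⟩
    (T + I * m) - T          ≤⟨ +-monoˡ-≤ (- T) (Ch-increment-≤ (ev-nonneg 0≤x c) c links c-i i≤n) ⟩
    (t + ℕ→ℚ n * m) - T      ≡⟨ cong (λ q → (t + q) - T) (n*[q*n⁻¹]≡q T) ⟩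
    (t + T) - T              ≡⟨ solve 2 (λ t T → (t :+ T) :- T := t) refl t T ⟩
    t                        ∎
    where
    open ≤-Reasoning
    I m : ℚ
    I = ℕ→ℚ i
    m = T * n⁻¹

  Ch-slide : ∀ {x m d} → 0ℚ ≤ d → d < m → LowerBound x m →
             ∀ {k t} (c : Ch n x k t) → SlidingLinks c → k ℕ.≤ n → Ch n (x + d) k (t - ℕ→ℚ k * d)
  Ch-slide {d = d} _ _ _ ch-zero _ _ =
    subst (Ch n _ 0) (solve 1 (λ d → con 1ℚ := con 1ℚ :- con 0ℚ :* d) refl d) ch-zero
  Ch-slide {x} {d = d} 0≤d d<m bound (ch-suc {i = k} {t = u} {t} c e) (links , slides) 1+k≤n =
    ch-suc (Ch-slide 0≤d d<m bound c links (ℕ.≤-trans (ℕ.n≤1+n k) 1+k≤n)) e′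
    where
    S K : ℚ
    S = ℕ→ℚ (suc k)
    K = ℕ→ℚ k
    0≤Sd : 0ℚ ≤ S * d
    0≤Sd = nonNegative⁻¹ (S * d)
      {{nonNeg*nonNeg⇒nonNeg S {{nonNegative (<⇒≤ (ℕ→ℚ-suc-pos k))}} d {{nonNegative 0≤d}}}}
    Sd<t : S * d < t
    Sd<t = <-≤-trans (*-monoʳ-<-pos S {{positive (ℕ→ℚ-suc-pos k)}} d<m)
                     (bound (suc k) 1+k≤n t (ch-suc c e))
    argument : (x - u) + S * d ≡ (x + d) - (u - K * d)
    argument = begin
      (x - u) + S * d         ≡⟨ cong (λ q → (x - u) + q * d) (ℕ→ℚ-suc k) ⟩
      (x - u) + (1ℚ + K) * d  ≡⟨ solve 4 (λ x u K d → (x :- u) :+ (con 1ℚ :+ K) :* d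
                                                  := (x :+ d) :- (u :- K :* d)) refl x u K d ⟩
      (x + d) - (u - K * d)   ∎
      where open ≡-Reasoning
    e′ : Ev n ((x + d) - (u - K * d)) (t - S * d)
    e′ = subst (λ y → Ev n y (t - S * d)) argument (slides (S * d) 0≤Sd Sd<t)

  mutual
    Ev-slides : ∀ {x v} → Ev n x v → Slides x v
    Ev-slides {x} (ev-neg x<0) d 0≤d d<-x =
      subst (Ev n (x + d)) (solve 2 (λ x d → :- (x :+ d) := (:- x) :- d) refl x d) (ev-neg x+d<0)
      where
      x+d<0 : x + d < 0ℚ
      x+d<0 = subst (x + d <_) (+-inverseʳ x) (+-monoʳ-< x d<-x)
    Ev-slides {x} (ev-nonneg {t = T} 0≤x c) d 0≤d d<m =
      subst (Ev n (x + d)) value (ev-nonneg 0≤x+d (Ch-slide 0≤d d<m bound c links ℕ.≤-refl))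
      where
      links : SlidingLinks c
      links = Ch-sliding-links c
      bound : LowerBound x (T * n⁻¹)
      bound = Ch-lower-bound 0≤x c links
      0≤x+d : 0ℚ ≤ x + d
      0≤x+d = ≤-trans 0≤x (p≤p+q 0≤d)
      value : (T - ℕ→ℚ n * d) * n⁻¹ ≡ T * n⁻¹ - d
      value = begin
        (T - ℕ→ℚ n * d) * n⁻¹        ≡⟨ solve 4 (λ T N d r → (T :- N :* d) :* r := T :* r :- (N :* r) :* d)
                                                refl T (ℕ→ℚ n) d n⁻¹ ⟩
        T * n⁻¹ - (ℕ→ℚ n * n⁻¹) * d  ≡⟨ cong (λ q → T * n⁻¹ - q * d) (ℕ→ℚ-*-inverse n) ⟩
        T * n⁻¹ - 1ℚ * d             ≡⟨ cong (λ q → T * n⁻¹ - q) (*-identityˡ d) ⟩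
        T * n⁻¹ - d                  ∎
        where open ≡-Reasoning

    Ch-sliding-links : ∀ {x k t} (c : Ch n x k t) → SlidingLinks c
    Ch-sliding-links ch-zero      = tt
    Ch-sliding-links (ch-suc c e) = Ch-sliding-links c , Ev-slides e

  Ev-lower-bound : ∀ {x m} → Ev n x m → 0ℚ ≤ x → LowerBound x m
  Ev-lower-bound (ev-neg x<0)      0≤x = ⊥-elim (<-irrefl refl (<-≤-trans x<0 0≤x))
  Ev-lower-bound (ev-nonneg 0≤x c) _   = Ch-lower-bound 0≤x c (Ch-sliding-links c)

lemma6p2 : (n : ℕ) .{{_ : NonZero n}} → 2 Data.Nat.≤ n →
    (x m : ℚ) → Ev n x m →
    ((d : ℚ) → 0ℚ ≤ d → d < m → Ev n (x + d) (m - d))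
    × (0ℚ ≤ x → (i : ℕ) → i Data.Nat.≤ n → (t : ℚ) → Ch n x i t → ℕ→ℚ i * m ≤ t)
lemma6p2 n _ x m e = Ev-slides n e , Ev-lower-bound n e
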